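{- Let $\mathbb{H}$ be a hypergraph of order $n$ with strong chromatic number $\chi'(\mathbb{H})=k'$, and let $h>k$ be nonnegative integers. Then $$\lambda_{h,k}(\mathbb{H})\le k(n-k')+(k'-1)h.$$
   Context: A hypergraph $\mathbb{H}=(V,E)$ consists of a finite vertex set $V$ and a family $E$ of subsets of $V$ (edges); all hypergraphs are simple: every edge has at least two elements and no edge contains another. A strong $t$-colouring of $\mathbb{H}$ is a partition $\{C_1,\dots,C_t\}$ of $V$ with $|C_i\cap e|\le 1$ for all $e\in E$ and all $i$; the strong chromatic number $\chi'(\mathbb{H})$ is the least such $t$. For nonnegative integers $h>k$, an $L(h,k)$-colouring of $\mathbb{H}$ is a map $f:V\to\mathbb{Z}_{\ge0}$ such that $|f(u)-f(v)|\ge h$ whenever $u\neq v$ lie in a common edge, and $|f(u)-f(v)|\ge k$ whenever $u\ne v$ and there exist edges $e_1\ni v$, $e_2\ni u$ with $(e_1\cap e_2)\setminus\{u,v\}\neq\emptyset$. The span of $f$ is $\max f-\min f$; $\lambda_{h,k}(\mathbb{H})$ is the minimum span of an $L(h,k)$-colouring. -}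

module Defs where

open import Data.Nat using (ℕ; _≤_; _<_; ∣_-_∣)
open import Data.Fin using (Fin)
open import Data.Fin.Subset using (Subset; _∈_; _⊆_; ∣_∣)
open import Data.Product using (Σ; ∃; ∃-syntax; _×_)
open import Relation.Nullary using (¬_)
open import Relation.Binary.PropositionalEquality using (_≡_; _≢_)

record Hypergraph (n : ℕ) : Set where
  field
    m        : ℕ
    edge     : Fin m → Subset n
    edge≥2   : ∀ i → 2 ≤ ∣ edge i ∣
    antichain : ∀ i j → i ≢ j → ¬ (edge i ⊆ edge j)
open Hypergraph public

Adjacent : ∀ {n} → Hypergraph n → Fin n → Fin n → Set
Adjacent H u v = ∃[ i ] (u ∈ edge H i × v ∈ edge H i)

AtDistanceTwo : ∀ {n} → Hypergraph n → Fin n → Fin n → Set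
AtDistanceTwo H u v =
  ∃[ i ] ∃[ j ] ∃[ w ]
    (v ∈ edge H i × u ∈ edge H j × w ∈ edge H i × w ∈ edge H j × w ≢ u × w ≢ v)

IsStrongColouring : ∀ {n} → Hypergraph n → (t : ℕ) → (Fin n → Fin t) → Set
IsStrongColouring H t c =
  ∀ i u v → u ∈ edge H i → v ∈ edge H i → c u ≡ c v → u ≡ v

StronglyColourable : ∀ {n} → Hypergraph n → ℕ → Set
StronglyColourable {n} H t = Σ (Fin n → Fin t) (IsStrongColouring H t)

StrongChromaticNumber : ∀ {n} → Hypergraph n → ℕ → Set
StrongChromaticNumber H k' =
  StronglyColourable H k' × (∀ t → t < k' → ¬ StronglyColourable H t)

IsLColouring : ∀ {n} → Hypergraph n → (h k : ℕ) → (Fin n → ℕ) → Set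
IsLColouring H h k f =
  (∀ u v → u ≢ v → Adjacent H u v → h ≤ ∣ f u - f v ∣) ×
  (∀ u v → u ≢ v → AtDistanceTwo H u v → k ≤ ∣ f u - f v ∣)

-- span f ≤ B, i.e. max f - min f ≤ B
SpanAtMost : ∀ {n} → (Fin n → ℕ) → ℕ → Set
SpanAtMost f B = ∀ u v → ∣ f u - f v ∣ ≤ B

-- λ_{h,k}(H) ≤ B : since λ is the minimum span, this holds iff some
-- L(h,k)-colouring has span at most B
LambdaAtMost : ∀ {n} → Hypergraph n → (h k B : ℕ) → Set
LambdaAtMost {n} H h k B =
  ∃[ f ] (IsLColouring H h k f × SpanAtMost {n} f B)

-- Sort the vertices lexicographically by (colour, vertex) and let r(v) < n be the
-- position of v in this order.  The labelling  f v = colour(v) · (h − k) + k · r(v)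
-- increases by at least k along the order and by at least h whenever the colour
-- increases; since a strong colouring gives distinct colours to distinct vertices
-- of an edge, f is an L(h,k)-colouring.  Its largest value (k' − 1)(h − k) + k(n − 1)
-- is at most k(n − k') + (k' − 1)h, with equality when k' ≤ n.
module Submission where

open import Defs
open import Data.Nat using (ℕ; _<_; _+_; _*_; _∸_)
open import Data.Nat as ℕ using (suc; _≤_; _<ᵇ_; ∣_-_∣)
open import Data.Nat.Properties
open import Data.Nat.Solver using (module +-*-Solver)
open import Data.Bool.Properties using (T-≡)
open import Data.Fin as Fin using (Fin; toℕ; combine)
open import Data.Fin.Properties as Finₚ
  using (toℕ<n; combine-monoˡ-<; combine-injectiveʳ)
open import Data.Fin.Subset using (Subset; ∣_∣) renaming (_∈_ to _∈ₛ_; _∉_ to _∉ₛ_)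
open import Data.Fin.Subset.Properties using (p⊂q⇒∣p∣<∣q∣; ∈⊤; ∣⊤∣≡n)
open import Data.Vec using (tabulate)
open import Data.Vec.Properties using (lookup∘tabulate; lookup⇒[]=; []=⇒lookup)
open import Data.Product using (_,_)
open import Data.Sum using (_⊎_; inj₁; inj₂)
open import Function using (_∘_; Equivalence)
open import Relation.Binary using (tri<; tri≈; tri>)
open import Relation.Binary.PropositionalEquality
open import Relation.Nullary using (contradiction)

≢⇒<⊎> : ∀ {m} {i j : Fin m} → i ≢ j → i Fin.< j ⊎ j Fin.< i
≢⇒<⊎> {i = i} {j} i≢j with Finₚ.<-cmp i j
... | tri< i<j _ _ = inj₁ i<j
... | tri≈ _ i≡j _ = contradiction i≡j i≢j
... | tri> _ _ j<i = inj₂ j<i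

m+o≤n⇒o≤∣m-n∣ : ∀ m n o → m + o ≤ n → o ≤ ∣ m - n ∣
m+o≤n⇒o≤∣m-n∣ m n o m+o≤n = begin
  o         ≤⟨ m+n≤o⇒m≤o∸n o (subst (_≤ n) (+-comm m o) m+o≤n) ⟩
  n ∸ m     ≡⟨ m≤n⇒∣m-n∣≡n∸m (m+n≤o⇒m≤o m m+o≤n) ⟨
  ∣ m - n ∣ ∎
  where open ≤-Reasoning

gap⇒≤∣-∣ : ∀ {A : Set} (f : A → ℕ) (R : A → A → Set) (o : ℕ) →
  (∀ {u v} → R u v → f u + o ≤ f v) →
  ∀ {u v} → R u v ⊎ R v u → o ≤ ∣ f u - f v ∣
gap⇒≤∣-∣ f R o gap {u} {v} (inj₁ uRv) = m+o≤n⇒o≤∣m-n∣ (f u) (f v) o (gap uRv)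
gap⇒≤∣-∣ f R o gap {u} {v} (inj₂ vRu) =
  subst (o ≤_) (∣-∣-comm (f v) (f u)) (m+o≤n⇒o≤∣m-n∣ (f v) (f u) o (gap vRu))

module Rank {n} (key : Fin n → ℕ) where

  below : Fin n → Subset n
  below v = tabulate (λ w → key w <ᵇ key v)

  ∈-below⁺ : ∀ {v w} → key w < key v → w ∈ₛ below v
  ∈-below⁺ {v} {w} w<v = lookup⇒[]= w (below v)
    (trans (lookup∘tabulate _ w) (Equivalence.to T-≡ (<⇒<ᵇ w<v)))

  ∈-below⁻ : ∀ {v w} → w ∈ₛ below v → key w < key v
  ∈-below⁻ {v} {w} w∈ = <ᵇ⇒< (key w) (key v)
    (Equivalence.from T-≡ (trans (sym (lookup∘tabulate _ w)) ([]=⇒lookup w∈)))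

  ∉-below-self : ∀ v → v ∉ₛ below v
  ∉-below-self v v∈ = <-irrefl refl (∈-below⁻ v∈)

  rank : Fin n → ℕ
  rank v = ∣ below v ∣

  rank-mono-< : ∀ {u v} → key u < key v → rank u < rank v
  rank-mono-< u<v = p⊂q⇒∣p∣<∣q∣
    ((λ w∈ → ∈-below⁺ (<-trans (∈-below⁻ w∈) u<v)) , _ , ∈-below⁺ u<v , ∉-below-self _)

  rank<n : ∀ v → rank v < n
  rank<n v = subst (rank v <_) (∣⊤∣≡n n)
    (p⊂q⇒∣p∣<∣q∣ ((λ _ → ∈⊤) , v , ∈⊤ , ∉-below-self v))

-- x is a colour index, p a rank; h = k + d.
module Label (k d : ℕ) where
  open +-*-Solver

  label : ℕ → ℕ → ℕ
  label x p = x * d + k * p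

  label-mono-≤ : ∀ {x x′ p p′} → x ≤ x′ → p ≤ p′ → label x p ≤ label x′ p′
  label-mono-≤ x≤x′ p≤p′ = +-mono-≤ (*-monoˡ-≤ d x≤x′) (*-monoʳ-≤ k p≤p′)

  label-+k : ∀ x p → label x p + k ≡ label x (suc p)
  label-+k x p = solve 4 (λ x p k d → x :* d :+ k :* p :+ k := x :* d :+ k :* (con 1 :+ p))
    refl x p k d

  label-+h : ∀ x p → label x p + (k + d) ≡ label (suc x) (suc p)
  label-+h x p = solve 4 (λ x p k d →
    x :* d :+ k :* p :+ (k :+ d) := (con 1 :+ x) :* d :+ k :* (con 1 :+ p)) refl x p k d

  label-diagonal : ∀ j r → label j (j + r) ≡ k * r + j * (k + d)
  label-diagonal j r = solve 4 (λ j r k d →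
    j :* d :+ k :* (j :+ r) := k :* r :+ j :* (k :+ d)) refl j r k d

  label-≤ : ∀ {x p t n} → x < t → p < n → label x p ≤ k * (n ∸ t) + (t ∸ 1) * (k + d)
  label-≤ {x} {p} {suc j} {n} x<t p<n = begin
    label x p                   ≤⟨ label-mono-≤ (ℕ.s≤s⁻¹ x<t) p≤j+r ⟩
    label j (j + (n ∸ suc j))   ≡⟨ label-diagonal j (n ∸ suc j) ⟩
    k * (n ∸ suc j) + j * (k + d) ∎
    where
    open ≤-Reasoning
    p≤j+r : p ≤ j + (n ∸ suc j)
    p≤j+r = ℕ.s≤s⁻¹ (≤-trans p<n (m≤n+m∸n n (suc j)))

module LexicographicLabelling {n t} (c : Fin n → Fin t) (k d : ℕ) where
  open Label k d

  key : Fin n → Fin (t * n)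
  key v = combine (c v) v

  open Rank (toℕ ∘ key)

  lexLabel : Fin n → ℕ
  lexLabel v = label (toℕ (c v)) (rank v)

  key-injective : ∀ {u v} → u ≢ v → key u ≢ key v
  key-injective {u} {v} u≢v ku≡kv = u≢v (combine-injectiveʳ (c u) u (c v) v ku≡kv)

  key-<⇒colour-≤ : ∀ {u v} → key u Fin.< key v → c u Fin.≤ c v
  key-<⇒colour-≤ {u} {v} ku<kv = ≮⇒≥ (λ cv<cu → <-asym ku<kv (combine-monoˡ-< v u cv<cu))

  lexLabel-gapₖ : ∀ {u v} → key u Fin.< key v → lexLabel u + k ≤ lexLabel v
  lexLabel-gapₖ {u} {v} ku<kv = begin
    lexLabel u + k                     ≡⟨ label-+k (toℕ (c u)) (rank u) ⟩
    label (toℕ (c u)) (suc (rank u))   ≤⟨ label-mono-≤ (key-<⇒colour-≤ ku<kv) (rank-mono-< ku<kv) ⟩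
    lexLabel v                         ∎
    where open ≤-Reasoning

  lexLabel-gapₕ : ∀ {u v} → c u Fin.< c v → lexLabel u + (k + d) ≤ lexLabel v
  lexLabel-gapₕ {u} {v} cu<cv = begin
    lexLabel u + (k + d)                     ≡⟨ label-+h (toℕ (c u)) (rank u) ⟩
    label (suc (toℕ (c u))) (suc (rank u))   ≤⟨ label-mono-≤ cu<cv (rank-mono-< (combine-monoˡ-< u v cu<cv)) ⟩
    lexLabel v                               ∎
    where open ≤-Reasoning

  lexLabel-isLColouring : (H : Hypergraph n) → IsStrongColouring H t c →
    IsLColouring H (k + d) k lexLabel
  lexLabel-isLColouring H strong = adjacent , atDistanceTwo
    where
    adjacent : ∀ u v → u ≢ v → Adjacent H u v → k + d ≤ ∣ lexLabel u - lexLabel v ∣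
    adjacent u v u≢v (i , u∈i , v∈i) =
      gap⇒≤∣-∣ lexLabel (λ u v → c u Fin.< c v) (k + d) lexLabel-gapₕ
        (≢⇒<⊎> (u≢v ∘ strong i u v u∈i v∈i))
    atDistanceTwo : ∀ u v → u ≢ v → AtDistanceTwo H u v → k ≤ ∣ lexLabel u - lexLabel v ∣
    atDistanceTwo u v u≢v _ =
      gap⇒≤∣-∣ lexLabel (λ u v → key u Fin.< key v) k lexLabel-gapₖ (≢⇒<⊎> (key-injective u≢v))

  lexLabel-span : SpanAtMost lexLabel (k * (n ∸ t) + (t ∸ 1) * (k + d))
  lexLabel-span u v = ≤-trans (∣m-n∣≤m⊔n (lexLabel u) (lexLabel v)) (⊔-lub (bounded u) (bounded v))
    where
    bounded : ∀ v → lexLabel v ≤ k * (n ∸ t) + (t ∸ 1) * (k + d)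
    bounded v = label-≤ (toℕ<n (c v)) (rank<n v)

stronglyColourable⇒λ≤ : ∀ {n t} (H : Hypergraph n) → StronglyColourable H t → ∀ k d →
  LambdaAtMost H (k + d) k (k * (n ∸ t) + (t ∸ 1) * (k + d))
stronglyColourable⇒λ≤ H (c , strong) k d =
  lexLabel , lexLabel-isLColouring H strong , lexLabel-span
  where open LexicographicLabelling c k d

mainTheorem5 : ∀ {n} (H : Hypergraph n) (k' h k : ℕ) →
    StrongChromaticNumber H k' → k < h →
    LambdaAtMost H h k (k * (n ∸ k') + (k' ∸ 1) * h)
mainTheorem5 H k' h k (colourable , _) k<h
  with d , refl ← m≤n⇒∃[o]m+o≡n (<⇒≤ k<h) = stronglyColourable⇒λ≤ H colourable k d
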